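{- For all positive integers $n\ge m$, $\eta(K_n\,\Box\, K_m)\le n\sqrt{m}+m$.
   Context: $K_n$ is the complete graph on $n$ vertices. The Cartesian product $G_1 \,\Box\, G_2$ has vertex set $V(G_1)\times V(G_2)$, and $(u,v)$ is adjacent to $(u',v')$ iff either $v=v'$ and $uu'\in E(G_1)$, or $u=u'$ and $vv'\in E(G_2)$. A graph $M$ is a minor of $G$ if it can be obtained from $G$ by deleting vertices and edges and contracting edges. The Hadwiger number $\eta(G)$ is the largest $k$ such that $K_k$ is a minor of $G$. -}

module Defs where

open import Level using (0ℓ)
open import Data.Nat using (ℕ)
open import Data.Fin using (Fin)
open import Data.Product using (Σ; ∃; _×_)
open import Relation.Binary.PropositionalEquality using (_≡_; _≢_)
open import Data.Empty using (⊥)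

record Graph : Set₁ where
  field
    V : Set
    E : V → V → Set
open Graph public

K : ℕ → Graph
K n = record { V = Fin n ; E = λ u v → u ≢ v }

_□_ : Graph → Graph → Graph
G₁ □ G₂ = record
  { V = V G₁ × V G₂
  ; E = λ p q → let open Data.Product in
          (proj₂ p ≡ proj₂ q × E G₁ (proj₁ p) (proj₁ q))
          Data.Sum.⊎ (proj₁ p ≡ proj₁ q × E G₂ (proj₂ p) (proj₂ q))
  }
  where import Data.Sum

data WalkIn (G : Graph) (B : V G → Set) : V G → V G → Set where
  here : ∀ {x} → B x → WalkIn G B x x
  step : ∀ {x y z} → B x → E G x y → WalkIn G B y z → WalkIn G B x z

ConnectedIn : (G : Graph) → (V G → Set) → Set
ConnectedIn G B = ∀ u v → B u → B v → WalkIn G B u v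

-- K_k is a minor of G, via a branch-set model: k nonempty, pairwise
-- disjoint, connected vertex sets, every two of which are joined by an edge.
HasCliqueMinor : Graph → ℕ → Set₁
HasCliqueMinor G k =
  Σ (Fin k → V G → Set) λ branch →
      (∀ i → ∃ λ v → branch i v)
    × (∀ i → ConnectedIn G (branch i))
    × (∀ i j v → i ≢ j → branch i v → branch j v → ⊥)
    × (∀ i j → i ≢ j → ∃ λ u → ∃ λ v → branch i u × branch j v × E G u v)

-- Fix a branch set B. Every branch set B′ contains a vertex equal or adjacent to a vertex of B; these
-- k vertices are distinct and lie on the rows and columns through B. Grow a tree T in B containing the
-- corresponding vertices of B one vertex at a time: the root lies on one row and one column (m + n
-- vertices), and each later vertex shares a line with its parent, so it adds one new line of at most
-- n vertices (as m ≤ n). Hence k ≤ m + n |T|. The trees of different branch sets are disjoint, so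
-- summing over them gives k² ≤ k m + n · n m, and (k ∸ m)² ≤ k (k ∸ m) ≤ n² m.
module Submission where

open import Defs
open import Data.Nat using (ℕ; zero; suc; _≤_; _+_; _*_; _∸_; z≤n; s≤s)
open import Data.Nat.Properties
open import Data.Nat.Tactic.RingSolver using (solve-∀)
import Data.Fin as Fin
open Fin using (Fin) renaming (_≟_ to _≟ᶠ_)
open import Data.Product using (∃; ∃₂; _×_; _,_; proj₁; proj₂)
open import Data.Product.Properties using (≡-dec)
open import Data.Sum using (_⊎_; inj₁; inj₂)
open import Data.List using (List; []; _∷_; [_]; _++_; length; map; concat; tabulate; allFin; cartesianProduct)
open import Data.List.Properties using (length-++; length-++-sucʳ; length-map; length-tabulate)
open import Data.List.Membership.Propositional using (_∈_; _∉_)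
open import Data.List.Membership.Propositional.Properties
  using (∈-∃++; ∈-++⁺ˡ; ∈-++⁺ʳ; ∈-++⁻; ∈-tabulate⁺; ∈-tabulate⁻; ∈-allFin; ∈-cartesianProduct⁺)
open import Data.List.Relation.Binary.Subset.Propositional using (_⊆_)
open import Data.List.Relation.Binary.Disjoint.Propositional using (Disjoint)
open import Data.List.Relation.Unary.Any using (here; there)
open import Data.List.Relation.Unary.All as All using (All; []; _∷_)
import Data.List.Relation.Unary.All.Properties as All
open import Data.List.Relation.Unary.All.Properties.Core using (¬Any⇒All¬)
import Data.List.Relation.Unary.AllPairs.Properties as AllPairs
open import Data.List.Relation.Unary.Unique.Propositional using (Unique; []; _∷_)
import Data.List.Relation.Unary.Unique.Propositional.Properties as Unique
open import Data.Empty using (⊥; ⊥-elim)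
open import Function using (id; _∘_)
open import Relation.Binary.Definitions using (DecidableEquality)
open import Relation.Binary.PropositionalEquality using (_≡_; _≢_; refl; sym; trans; cong; cong₂; subst; module ≡-Reasoning)
open import Relation.Nullary using (yes; no)
open import Relation.Nullary.Decidable using (decidable-stable)

module _ {A : Set} where

  ∈-++-∷⁻ : ∀ (as : List A) {bs x y} → y ∈ as ++ x ∷ bs → y ≢ x → y ∈ as ++ bs
  ∈-++-∷⁻ as y∈ y≢x with ∈-++⁻ as y∈
  ... | inj₁ y∈as         = ∈-++⁺ˡ y∈as
  ... | inj₂ (here y≡x)   = ⊥-elim (y≢x y≡x)
  ... | inj₂ (there y∈bs) = ∈-++⁺ʳ as y∈bs

  unique∧⊆⇒length≤ : ∀ {xs ys : List A} → Unique xs → xs ⊆ ys → length xs ≤ length ys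
  unique∧⊆⇒length≤ {[]} _ _ = z≤n
  unique∧⊆⇒length≤ {x ∷ xs} {ys} (x∉xs ∷ xs!) x∷xs⊆ys with ∈-∃++ (x∷xs⊆ys (here refl))
  ... | as , bs , refl = begin
    suc (length xs)          ≤⟨ s≤s (unique∧⊆⇒length≤ xs! xs⊆as++bs) ⟩
    suc (length (as ++ bs))  ≡⟨ length-++-sucʳ as x bs ⟨
    length (as ++ x ∷ bs)    ∎
    where
    open ≤-Reasoning
    xs⊆as++bs : xs ⊆ as ++ bs
    xs⊆as++bs y∈xs = ∈-++-∷⁻ as (x∷xs⊆ys (there y∈xs)) (All.lookup x∉xs y∈xs ∘ sym)

  injective∧⊆⇒≤length : ∀ {k} (f : Fin k → A) (ys : List A) →
    (∀ {i j} → f i ≡ f j → i ≡ j) → (∀ i → f i ∈ ys) → k ≤ length ys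
  injective∧⊆⇒≤length {k} f ys f-inj f∈ys = begin
    k                   ≡⟨ length-tabulate f ⟨
    length (tabulate f) ≤⟨ unique∧⊆⇒length≤ (Unique.tabulate⁺ f-inj) image⊆ys ⟩
    length ys           ∎
    where
    open ≤-Reasoning
    image⊆ys : tabulate f ⊆ ys
    image⊆ys v∈ with ∈-tabulate⁻ v∈
    ... | i , refl = f∈ys i

length-cartesianProduct : ∀ {A B : Set} (xs : List A) (ys : List B) →
  length (cartesianProduct xs ys) ≡ length xs * length ys
length-cartesianProduct []       ys = refl
length-cartesianProduct (x ∷ xs) ys = begin
  length (map (x ,_) ys ++ cartesianProduct xs ys)  ≡⟨ length-++ (map (x ,_) ys) ⟩
  length (map (x ,_) ys) + length (cartesianProduct xs ys)
    ≡⟨ cong₂ _+_ (length-map (x ,_) ys) (length-cartesianProduct xs ys) ⟩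
  length ys + length xs * length ys  ∎
  where open ≡-Reasoning

length-concat-tabulate-≥ : ∀ {A : Set} {a b c} k (W : Fin k → List A) →
  (∀ i → c ≤ a + b * length (W i)) → k * c ≤ k * a + b * length (concat (tabulate W))
length-concat-tabulate-≥ zero    W bound = z≤n
length-concat-tabulate-≥ {a = a} {b} {c} (suc k) W bound = begin
  c + k * c
    ≤⟨ +-mono-≤ (bound Fin.zero) (length-concat-tabulate-≥ {b = b} k (W ∘ Fin.suc) (bound ∘ Fin.suc)) ⟩
  (a + b * w) + (k * a + b * l)                   ≡⟨ rearrange a b w (k * a) l ⟩
  (a + k * a) + b * (w + l)                       ≡⟨ cong (λ x → a + k * a + b * x) (length-++ (W Fin.zero)) ⟨
  (a + k * a) + b * length (concat (tabulate W))  ∎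
  where
  open ≤-Reasoning
  w = length (W Fin.zero)
  l = length (concat (tabulate (W ∘ Fin.suc)))
  rearrange : ∀ a b w ka l → (a + b * w) + (ka + b * l) ≡ (a + ka) + b * (w + l)
  rearrange = solve-∀

square-∸-bound : ∀ k m {c} → k * k ≤ k * m + c → (k ∸ m) * (k ∸ m) ≤ c
square-∸-bound k m {c} k²≤ = begin
  (k ∸ m) * (k ∸ m)  ≤⟨ *-monoˡ-≤ (k ∸ m) (m∸n≤m k m) ⟩
  k * (k ∸ m)        ≡⟨ *-distribˡ-∸ k k m ⟩
  k * k ∸ k * m      ≤⟨ m≤n+o⇒m∸n≤o (k * k) (k * m) k²≤ ⟩
  c                  ∎
  where open ≤-Reasoning

data TreeIn (G : Graph) (B : V G → Set) : List (V G) → Set where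
  root : ∀ {r} → B r → TreeIn G B [ r ]
  grow : ∀ {W y z} → TreeIn G B W → y ∈ W → E G y z → z ∉ W → B z → TreeIn G B (z ∷ W)

module _ {G : Graph} {B : V G → Set} where

  treeIn-unique : ∀ {W} → TreeIn G B W → Unique W
  treeIn-unique (root _)               = [] ∷ []
  treeIn-unique (grow {W} t _ _ z∉W _) = ¬Any⇒All¬ W z∉W ∷ treeIn-unique t

  treeIn-inside : ∀ {W} → TreeIn G B W → All B W
  treeIn-inside (root br)         = br ∷ []
  treeIn-inside (grow t _ _ _ bz) = bz ∷ treeIn-inside t

  walkIn-start : ∀ {x y} → WalkIn G B x y → B x
  walkIn-start (here bx)     = bx
  walkIn-start (step bx _ _) = bx

  module _ (_≟_ : DecidableEquality (V G)) (connected : ConnectedIn G B) where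

    open import Data.List.Membership.DecPropositional _≟_ using (_∈?_)

    attach-walk : ∀ {W y u} → TreeIn G B W → y ∈ W → WalkIn G B y u →
      ∃ λ W′ → TreeIn G B W′ × W ⊆ W′ × u ∈ W′
    attach-walk t y∈W (here _) = _ , t , id , y∈W
    attach-walk {W} t y∈W (step {y = z} _ yz walk) with z ∈? W
    ... | yes z∈W = attach-walk t z∈W walk
    ... | no  z∉W with attach-walk (grow t y∈W yz z∉W (walkIn-start walk)) (here refl) walk
    ...   | W′ , t′ , z∷W⊆W′ , u∈W′ = W′ , t′ , z∷W⊆W′ ∘ there , u∈W′

    attach : ∀ {W u} → TreeIn G B W → B u → ∃ λ W′ → TreeIn G B W′ × W ⊆ W′ × u ∈ W′
    attach t bu with treeIn-inside t
    ... | bx ∷ _ = attach-walk t (here refl) (connected _ _ bx bu)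

    attach-all : ∀ {W us} → TreeIn G B W → All B us → ∃ λ W′ → TreeIn G B W′ × W ⊆ W′ × us ⊆ W′
    attach-all t []            = _ , t , id , λ ()
    attach-all t (bu ∷ bus) with attach t bu
    ... | W₁ , t₁ , W⊆W₁ , u∈W₁ with attach-all t₁ bus
    ...   | W₂ , t₂ , W₁⊆W₂ , us⊆W₂ =
      W₂ , t₂ , W₁⊆W₂ ∘ W⊆W₁ , λ { (here refl) → W₁⊆W₂ u∈W₁ ; (there u′∈us) → us⊆W₂ u′∈us }

module Rook {n m : ℕ} where

  Vertex : Set
  Vertex = Fin n × Fin m

  SameLine : Vertex → Vertex → Set
  SameLine v w = proj₁ v ≡ proj₁ w ⊎ proj₂ v ≡ proj₂ w

  row : Fin n → List Vertex
  row a = tabulate (a ,_)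

  col : Fin m → List Vertex
  col b = tabulate (_, b)

  length-row : ∀ a → length (row a) ≡ m
  length-row a = length-tabulate (a ,_)

  length-col : ∀ b → length (col b) ≡ n
  length-col b = length-tabulate (_, b)

  ∈-row : ∀ {a v} → a ≡ proj₁ v → v ∈ row a
  ∈-row {v = _ , b} refl = ∈-tabulate⁺ b

  ∈-col : ∀ {b v} → b ≡ proj₂ v → v ∈ col b
  ∈-col {v = a , _} refl = ∈-tabulate⁺ a

  allVertices : List Vertex
  allVertices = cartesianProduct (allFin n) (allFin m)

  ∈-allVertices : ∀ v → v ∈ allVertices
  ∈-allVertices (a , b) = ∈-cartesianProduct⁺ (∈-allFin a) (∈-allFin b)

  length-allVertices : length allVertices ≡ n * m
  length-allVertices = begin
    length allVertices                       ≡⟨ length-cartesianProduct (allFin n) (allFin m) ⟩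
    length (allFin n) * length (allFin m)    ≡⟨ cong₂ _*_ (length-tabulate {n = n} id) (length-tabulate {n = m} id) ⟩
    n * m                                    ∎
    where open ≡-Reasoning

  ≡⊎adjacent⇒sameLine : ∀ {v w} → v ≡ w ⊎ E (K n □ K m) v w → SameLine v w
  ≡⊎adjacent⇒sameLine (inj₁ refl)                   = inj₁ refl
  ≡⊎adjacent⇒sameLine (inj₂ (inj₁ (same-col , _))) = inj₂ same-col
  ≡⊎adjacent⇒sameLine (inj₂ (inj₂ (same-row , _))) = inj₁ same-row

  module _ {B : Vertex → Set} where

    -- The parent of z shares z's column (inj₁) or z's row (inj₂), so only the other line through z is new.
    lineCover : ∀ {W} → TreeIn (K n □ K m) B W → List Vertex
    lineCover (root {r} _)                     = row (proj₁ r) ++ col (proj₂ r)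
    lineCover (grow {z = z} t _ (inj₁ _) _ _) = row (proj₁ z) ++ lineCover t
    lineCover (grow {z = z} t _ (inj₂ _) _ _) = col (proj₂ z) ++ lineCover t

    lineCover-complete : ∀ {W v w} (t : TreeIn (K n □ K m) B W) →
      w ∈ W → SameLine w v → v ∈ lineCover t
    lineCover-complete (root _) (here refl) (inj₁ e) = ∈-++⁺ˡ (∈-row e)
    lineCover-complete (root {r} _) (here refl) (inj₂ e) = ∈-++⁺ʳ (row (proj₁ r)) (∈-col e)
    lineCover-complete (grow t _ (inj₁ _) _ _) (here refl) (inj₁ e) = ∈-++⁺ˡ (∈-row e)
    lineCover-complete (grow {z = z} t y∈W (inj₁ (same-col , _)) _ _) (here refl) (inj₂ e) =
      ∈-++⁺ʳ (row (proj₁ z)) (lineCover-complete t y∈W (inj₂ (trans same-col e)))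
    lineCover-complete (grow {z = z} t y∈W (inj₂ (same-row , _)) _ _) (here refl) (inj₁ e) =
      ∈-++⁺ʳ (col (proj₂ z)) (lineCover-complete t y∈W (inj₁ (trans same-row e)))
    lineCover-complete (grow t _ (inj₂ _) _ _) (here refl) (inj₂ e) = ∈-++⁺ˡ (∈-col e)
    lineCover-complete (grow {z = z} t _ (inj₁ _) _ _) (there w∈W) s =
      ∈-++⁺ʳ (row (proj₁ z)) (lineCover-complete t w∈W s)
    lineCover-complete (grow {z = z} t _ (inj₂ _) _ _) (there w∈W) s =
      ∈-++⁺ʳ (col (proj₂ z)) (lineCover-complete t w∈W s)

    add-line : ∀ {R w} (line : List Vertex) →
      length line ≤ n → length R ≤ m + n * w → length (line ++ R) ≤ m + n * suc w
    add-line {R} {w} line line≤n R≤ = begin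
      length (line ++ R)     ≡⟨ length-++ line ⟩
      length line + length R ≤⟨ +-mono-≤ line≤n R≤ ⟩
      n + (m + n * w)        ≡⟨ rearrange n m w ⟩
      m + n * suc w          ∎
      where
      open ≤-Reasoning
      rearrange : ∀ n m w → n + (m + n * w) ≡ m + n * suc w
      rearrange = solve-∀

    length-lineCover : m ≤ n → ∀ {W} (t : TreeIn (K n □ K m) B W) →
      length (lineCover t) ≤ m + n * length W
    length-lineCover _ (root {r} _) = ≤-reflexive (begin
      length (row (proj₁ r) ++ col (proj₂ r))  ≡⟨ length-++ (row (proj₁ r)) ⟩
      length (row (proj₁ r)) + length (col (proj₂ r))
        ≡⟨ cong₂ _+_ (length-row (proj₁ r)) (length-col (proj₂ r)) ⟩
      m + n                                  ≡⟨ cong (m +_) (*-identityʳ n) ⟨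
      m + n * 1                              ∎)
      where open ≡-Reasoning
    length-lineCover m≤n (grow {z = z} t _ (inj₁ _) _ _) =
      add-line (row (proj₁ z)) (≤-trans (≤-reflexive (length-row (proj₁ z))) m≤n) (length-lineCover m≤n t)
    length-lineCover m≤n (grow {z = z} t _ (inj₂ _) _ _) =
      add-line (col (proj₂ z)) (≤-reflexive (length-col (proj₂ z))) (length-lineCover m≤n t)

module CliqueModel {G : Graph} {k : ℕ} (model : HasCliqueMinor G k) where

  branch : Fin k → V G → Set
  branch = proj₁ model

  nonempty : ∀ i → ∃ (branch i)
  nonempty = proj₁ (proj₂ model)

  connected : ∀ i → ConnectedIn G (branch i)
  connected = proj₁ (proj₂ (proj₂ model))

  disjoint : ∀ i j v → i ≢ j → branch i v → branch j v → ⊥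
  disjoint = proj₁ (proj₂ (proj₂ (proj₂ model)))

  touching : ∀ i j → i ≢ j → ∃₂ λ u v → branch i u × branch j v × E G u v
  touching = proj₂ (proj₂ (proj₂ (proj₂ model)))

  record Contact (i j : Fin k) : Set where
    field
      from to : V G
      from∈   : branch i from
      to∈     : branch j to
      from~to : from ≡ to ⊎ E G from to
  open Contact public

  contact : ∀ i j → Contact i j
  contact i j with i ≟ᶠ j
  ... | yes refl = let v , v∈ = nonempty i in
    record { from = v ; to = v ; from∈ = v∈ ; to∈ = v∈ ; from~to = inj₁ refl }
  ... | no i≢j = let u , v , u∈ , v∈ , uv = touching i j i≢j in
    record { from = u ; to = v ; from∈ = u∈ ; to∈ = v∈ ; from~to = inj₂ uv }

  contacts⊆⇒k≤length : ∀ i (R : List (V G)) → (∀ j → to (contact i j) ∈ R) → k ≤ length R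
  contacts⊆⇒k≤length i R = injective∧⊆⇒≤length (to ∘ contact i) R injective
    where
    injective : ∀ {j j′} → to (contact i j) ≡ to (contact i j′) → j ≡ j′
    injective {j} {j′} eq = decidable-stable (j ≟ᶠ j′) λ j≢j′ →
      disjoint j j′ _ j≢j′ (to∈ (contact i j)) (subst (branch j′) (sym eq) (to∈ (contact i j′)))

  length-concat-branchLists≤ : (W : Fin k → List (V G)) →
    (∀ i → Unique (W i)) → (∀ i → All (branch i) (W i)) →
    (vs : List (V G)) → (∀ v → v ∈ vs) → length (concat (tabulate W)) ≤ length vs
  length-concat-branchLists≤ W W! W⊆branch vs ∈vs =
    unique∧⊆⇒length≤ (Unique.concat⁺ (All.tabulate⁺ W!) (AllPairs.tabulate⁺ W-disjoint)) (λ {v} _ → ∈vs v)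
    where
    W-disjoint : ∀ {i j} → i ≢ j → Disjoint (W i) (W j)
    W-disjoint {i} {j} i≢j (v∈Wi , v∈Wj) =
      disjoint i j _ i≢j (All.lookup (W⊆branch i) v∈Wi) (All.lookup (W⊆branch j) v∈Wj)

module RookCliqueModel {n m k : ℕ} (m≤n : m ≤ n) (model : HasCliqueMinor (K n □ K m) k) where

  open CliqueModel model
  open Rook {n} {m}

  spanningTree : ∀ i → ∃ λ W → TreeIn (K n □ K m) (branch i) W × tabulate (from ∘ contact i) ⊆ W
  spanningTree i
    with attach-all (≡-dec _≟ᶠ_ _≟ᶠ_) (connected i) (root (proj₂ (nonempty i))) (All.tabulate⁺ (from∈ ∘ contact i))
  ... | W , t , _ , froms⊆W = W , t , froms⊆W

  treeList : Fin k → List Vertex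
  treeList i = proj₁ (spanningTree i)

  tree : ∀ i → TreeIn (K n □ K m) (branch i) (treeList i)
  tree i = proj₁ (proj₂ (spanningTree i))

  k≤m+n*length-treeList : ∀ i → k ≤ m + n * length (treeList i)
  k≤m+n*length-treeList i = begin
    k                              ≤⟨ contacts⊆⇒k≤length i (lineCover (tree i)) to∈lineCover ⟩
    length (lineCover (tree i))    ≤⟨ length-lineCover m≤n (tree i) ⟩
    m + n * length (treeList i)    ∎
    where
    open ≤-Reasoning
    to∈lineCover : ∀ j → to (contact i j) ∈ lineCover (tree i)
    to∈lineCover j = lineCover-complete (tree i) (proj₂ (proj₂ (spanningTree i)) (∈-tabulate⁺ j))
      (≡⊎adjacent⇒sameLine (from~to (contact i j)))

  length-concat-treeLists≤ : length (concat (tabulate treeList)) ≤ n * m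
  length-concat-treeLists≤ = begin
    length (concat (tabulate treeList))
      ≤⟨ length-concat-branchLists≤ treeList (treeIn-unique ∘ tree) (treeIn-inside ∘ tree)
           allVertices ∈-allVertices ⟩
    length allVertices  ≡⟨ length-allVertices ⟩
    n * m               ∎
    where open ≤-Reasoning

mainTheorem4 : (n m : ℕ) → 1 ≤ m → m ≤ n → (k : ℕ) →
    HasCliqueMinor (K n □ K m) k →
    (k ∸ m) * (k ∸ m) ≤ n * n * m
mainTheorem4 n m _ m≤n k model = square-∸-bound k m (begin
  k * k                                            ≤⟨ length-concat-tabulate-≥ {b = n} k treeList k≤m+n*length-treeList ⟩
  k * m + n * length (concat (tabulate treeList))  ≤⟨ +-monoʳ-≤ (k * m) (*-monoʳ-≤ n length-concat-treeLists≤) ⟩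
  k * m + n * (n * m)                              ≡⟨ cong (k * m +_) (*-assoc n n m) ⟨
  k * m + n * n * m                                ∎)
  where
  open ≤-Reasoning
  open RookCliqueModel m≤n model
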